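{- Let $E$ be a lattice effect algebra and $a,b\in E$. Then $$a\wedge b=a\otimes(a\rightarrow_s b)=b\otimes(b\rightarrow_s a)=(a\rightarrow_s(a\rightarrow_s b)')'=(b\rightarrow_s(b\rightarrow_s a)')'.$$
   Context: An effect algebra is a structure $(E;\oplus,0,1)$ with $\oplus$ a partial binary operation such that for all $a,b,c$: (E1) if $a\oplus b$ is defined then $b\oplus a$ is defined and equal to it; (E2) if $b\oplus c$ and $a\oplus(b\oplus c)$ are defined then $a\oplus b$ and $(a\oplus b)\oplus c$ are defined and $a\oplus(b\oplus c)=(a\oplus b)\oplus c$; (E3) for every $a$ there is a unique $a'$ (the orthosupplement) with $a\oplus a'$ defined and equal to $1$; (E4) if $a\oplus 1$ is defined then $a=0$. The relation $a\leq b$ iff $a\oplus c=b$ for some $c$ is a partial order; a lattice effect algebra is an effect algebra for which this order is a lattice, with meet $\wedge$ and join $\vee$. The Sasaki product is $a\otimes b:=(a'\oplus(a\wedge b'))'$ and the Sasaki arrow is $a\rightarrow_s b:=a'\oplus(a\wedge b)$; both are total operations. -}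

module Defs where

open import Level using (Level; suc)
open import Data.Maybe using (Maybe; just)
open import Data.Product using (Σ; _×_; proj₁)
open import Relation.Binary.PropositionalEquality using (_≡_)

-- Partial binary operation encoded as  E → E → Maybe E ;
-- "a ⊕ b is defined and equals c" means  a ⊕ b ≡ just c.
record EffectAlgebra (ℓ : Level) : Set (suc ℓ) where
  field
    Carrier : Set ℓ
    _⊕_     : Carrier → Carrier → Maybe Carrier
    𝟘 𝟙     : Carrier
    comm    : ∀ a b c → a ⊕ b ≡ just c → b ⊕ a ≡ just c
    assoc   : ∀ a b c bc abc → b ⊕ c ≡ just bc → a ⊕ bc ≡ just abc →
              Σ Carrier λ ab → (a ⊕ b ≡ just ab) × (ab ⊕ c ≡ just abc)
    supp      : ∀ a → Σ Carrier λ a' → a ⊕ a' ≡ just 𝟙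
    supp-uniq : ∀ a x y → a ⊕ x ≡ just 𝟙 → a ⊕ y ≡ just 𝟙 → x ≡ y
    zero-one : ∀ a c → a ⊕ 𝟙 ≡ just c → a ≡ 𝟘

  _′ : Carrier → Carrier
  a ′ = proj₁ (supp a)

  _≤_ : Carrier → Carrier → Set ℓ
  a ≤ b = Σ Carrier λ c → a ⊕ c ≡ just b

record LatticeEffectAlgebra (ℓ : Level) : Set (suc ℓ) where
  field
    effectAlgebra : EffectAlgebra ℓ
  open EffectAlgebra effectAlgebra public
  field
    _∧_ _∨_ : Carrier → Carrier → Carrier
    ∧-lb₁ : ∀ a b → (a ∧ b) ≤ a
    ∧-lb₂ : ∀ a b → (a ∧ b) ≤ b
    ∧-glb : ∀ a b c → c ≤ a → c ≤ b → c ≤ (a ∧ b)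
    ∨-ub₁ : ∀ a b → a ≤ (a ∨ b)
    ∨-ub₂ : ∀ a b → b ≤ (a ∨ b)
    ∨-lub : ∀ a b c → a ≤ c → b ≤ c → (a ∨ b) ≤ c

  -- Sasaki arrow  a →s b := a' ⊕ (a ∧ b)  (as a partial value; it is in fact total)
  _→ₛ_ : Carrier → Carrier → Maybe Carrier
  a →ₛ b = (a ′) ⊕ (a ∧ b)

  -- Sasaki product  a ⊗ b := (a' ⊕ (a ∧ b'))'
  -- "a ⊗ b is defined and equals x":
  IsSasakiProduct : Carrier → Carrier → Carrier → Set ℓ
  IsSasakiProduct a b x = Σ Carrier λ s → (((a ′) ⊕ (a ∧ (b ′))) ≡ just s) × (x ≡ s ′)

-- The whole theorem rests on one observation about any d ≤ x, say
-- d ⊕ c = x.  Then x' ⊕ d is defined, and its orthosupplement is the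
-- difference c (a general effect-algebra fact: if d ⊕ c = x then
-- (x' ⊕ d)' = c).  Since c ≤ x we get x ∧ c = c, so the Sasaki product
-- x ⊗ (x' ⊕ d) equals (x' ⊕ c)' = d, by the same fact applied to c ⊕ d = x.
-- Taking d = a ∧ b and x = a (resp. x = b, using a ∧ b = b ∧ a), the element
-- x' ⊕ d is exactly the Sasaki arrow a →s b (resp. b →s a), and the term
-- x' ⊕ (x ∧ u') defining the Sasaki product is literally the Sasaki arrow
-- a →s u', which gives the remaining two equalities.
module Submission where

open import Defs
open import Data.Maybe using (Maybe; just)
open import Data.Maybe.Properties using (just-injective)
open import Data.Product using (Σ; _×_; _,_; proj₂)
open import Relation.Binary.PropositionalEquality
  using (_≡_; refl; sym; trans; subst)

module EffectAlgebraFacts {ℓ} (E : EffectAlgebra ℓ) where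
  open EffectAlgebra E

  defined-unique : ∀ {m : Maybe Carrier} {x y} → m ≡ just x → m ≡ just y → x ≡ y
  defined-unique p q = just-injective (trans (sym p) q)

  ⊕-′ : ∀ a → a ⊕ (a ′) ≡ just 𝟙
  ⊕-′ a = proj₂ (supp a)

  ′-⊕ : ∀ a → (a ′) ⊕ a ≡ just 𝟙
  ′-⊕ a = comm a (a ′) 𝟙 (⊕-′ a)

  supp-uniqˡ : ∀ a x y → x ⊕ a ≡ just 𝟙 → y ⊕ a ≡ just 𝟙 → x ≡ y
  supp-uniqˡ a x y p q = supp-uniq a x y (comm x a 𝟙 p) (comm y a 𝟙 q)

  assocʳ : ∀ a b c ab abc → a ⊕ b ≡ just ab → ab ⊕ c ≡ just abc →
           Σ Carrier λ bc → (b ⊕ c ≡ just bc) × (a ⊕ bc ≡ just abc)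
  assocʳ a b c ab abc a⊕b ab⊕c
    with assoc c b a ab abc (comm a b ab a⊕b) (comm ab c abc ab⊕c)
  ... | cb , c⊕b , cb⊕a = cb , comm c b cb c⊕b , comm cb a abc cb⊕a

  supplement-of-sum : ∀ a b x → a ⊕ b ≡ just x →
                      Σ Carrier λ u → ((x ′) ⊕ a ≡ just u) × (u ′ ≡ b)
  supplement-of-sum a b x a⊕b with assoc (x ′) a b x 𝟙 a⊕b (′-⊕ x)
  ... | u , x′⊕a , u⊕b = u , x′⊕a , supp-uniq u (u ′) b (⊕-′ u) u⊕b

  𝟙′≡𝟘 : 𝟙 ′ ≡ 𝟘
  𝟙′≡𝟘 = zero-one (𝟙 ′) 𝟙 (′-⊕ 𝟙)

  𝟘-identityˡ : ∀ a → 𝟘 ⊕ a ≡ just a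
  𝟘-identityˡ a with supplement-of-sum a (a ′) 𝟙 (⊕-′ a)
  ... | u , 𝟙′⊕a , u′≡a′ =
    subst (λ z → z ⊕ a ≡ just a) 𝟙′≡𝟘
      (subst (λ z → (𝟙 ′) ⊕ a ≡ just z) (supp-uniqˡ (a ′) u a u⊕a′ (⊕-′ a)) 𝟙′⊕a)
    where
    u⊕a′ : u ⊕ (a ′) ≡ just 𝟙
    u⊕a′ = subst (λ z → u ⊕ z ≡ just 𝟙) u′≡a′ (⊕-′ u)

  𝟘-identityʳ : ∀ a → a ⊕ 𝟘 ≡ just a
  𝟘-identityʳ a = comm 𝟘 a a (𝟘-identityˡ a)

  ⊕-cancelˡ : ∀ a b c d → a ⊕ b ≡ just d → a ⊕ c ≡ just d → b ≡ c
  ⊕-cancelˡ a b c d a⊕b a⊕c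
    with supplement-of-sum a b d a⊕b | supplement-of-sum a c d a⊕c
  ... | u , d′⊕a , u′≡b | v , d′⊕a₂ , v′≡c
    with defined-unique d′⊕a d′⊕a₂
  ... | refl = trans (sym u′≡b) v′≡c

  ⊕-positiveʳ : ∀ c d → c ⊕ d ≡ just 𝟘 → d ≡ 𝟘
  ⊕-positiveʳ c d c⊕d with assocʳ c d 𝟙 𝟘 𝟙 c⊕d (𝟘-identityˡ 𝟙)
  ... | x , d⊕𝟙 , _ = zero-one d x d⊕𝟙

  ⊕-positiveˡ : ∀ c d → c ⊕ d ≡ just 𝟘 → c ≡ 𝟘
  ⊕-positiveˡ c d c⊕d = ⊕-positiveʳ d c (comm c d 𝟘 c⊕d)

  ≤-refl : ∀ c → c ≤ c
  ≤-refl c = 𝟘 , 𝟘-identityʳ c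

  -- If a ⊕ c = b and b ⊕ d = a then c ⊕ d = 𝟘 by cancellation, so c = 𝟘.
  ≤-antisym : ∀ a b → a ≤ b → b ≤ a → a ≡ b
  ≤-antisym a b (c , a⊕c) (d , b⊕d) with assocʳ a c d b a a⊕c b⊕d
  ... | cd , c⊕d , a⊕cd with ⊕-cancelˡ a cd 𝟘 a a⊕cd (𝟘-identityʳ a)
  ... | refl with ⊕-positiveˡ c d c⊕d
  ... | refl = defined-unique (𝟘-identityʳ a) a⊕c

module LatticeFacts {ℓ} (L : LatticeEffectAlgebra ℓ) where
  open LatticeEffectAlgebra L
  open EffectAlgebraFacts effectAlgebra

  ∧-comm : ∀ a b → a ∧ b ≡ b ∧ a
  ∧-comm a b = ≤-antisym (a ∧ b) (b ∧ a)
    (∧-glb b a (a ∧ b) (∧-lb₂ a b) (∧-lb₁ a b))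
    (∧-glb a b (b ∧ a) (∧-lb₂ b a) (∧-lb₁ b a))

  ∧-absorb-≤ : ∀ x c → c ≤ x → x ∧ c ≡ c
  ∧-absorb-≤ x c c≤x =
    ≤-antisym (x ∧ c) c (∧-lb₂ x c) (∧-glb x c c c≤x (≤-refl c))

  sasaki-product-recovers : ∀ x d → d ≤ x →
    Σ Carrier λ u → ((x ′) ⊕ d ≡ just u) × IsSasakiProduct x u d
  sasaki-product-recovers x d (c , d⊕c)
    with supplement-of-sum d c x d⊕c
       | supplement-of-sum c d x (comm d c x d⊕c)
  ... | u , x′⊕d , u′≡c | s , x′⊕c , s′≡d =
    u , x′⊕d , s , x′⊕[x∧u′] , sym s′≡d
    where
    x∧u′≡c : x ∧ (u ′) ≡ c
    x∧u′≡c = subst (λ z → x ∧ z ≡ c) (sym u′≡c)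
               (∧-absorb-≤ x c (d , comm d c x d⊕c))

    x′⊕[x∧u′] : (x ′) ⊕ (x ∧ (u ′)) ≡ just s
    x′⊕[x∧u′] = subst (λ z → (x ′) ⊕ z ≡ just s) (sym x∧u′≡c) x′⊕c

-- Apply the key lemma to a ∧ b ≤ a and a ∧ b ≤ b.  The Sasaki arrow a →s u'
-- is by definition the element whose supplement is the Sasaki product a ⊗ u.
mainTheorem5 : ∀ {ℓ} (L : LatticeEffectAlgebra ℓ) → let open LatticeEffectAlgebra L in
    ∀ a b → Σ Carrier λ u → Σ Carrier λ v →
      ((a →ₛ b) ≡ just u) × ((b →ₛ a) ≡ just v) ×
      IsSasakiProduct a u (a ∧ b) × IsSasakiProduct b v (a ∧ b) ×
      Σ Carrier λ p → Σ Carrier λ q →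
        ((a →ₛ (u ′)) ≡ just p) × ((b →ₛ (v ′)) ≡ just q) ×
        ((a ∧ b) ≡ p ′) × ((a ∧ b) ≡ q ′)
mainTheorem5 L a b
  with sasaki-product-recovers a (a ∧ b) (∧-lb₁ a b)
     | sasaki-product-recovers b (a ∧ b) (∧-lb₂ a b)
  where open LatticeEffectAlgebra L
        open LatticeFacts L
... | u , a→ₛb , (p , a→ₛu′ , a∧b≡p′) | v , b′⊕[a∧b] , (q , b→ₛv′ , a∧b≡q′) =
  u , v , a→ₛb , b→ₛa ,
  (p , a→ₛu′ , a∧b≡p′) , (q , b→ₛv′ , a∧b≡q′) ,
  p , q , a→ₛu′ , b→ₛv′ , a∧b≡p′ , a∧b≡q′
  where
  open LatticeEffectAlgebra L
  open LatticeFacts L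
  b→ₛa : (b ′) ⊕ (b ∧ a) ≡ just v
  b→ₛa = subst (λ z → (b ′) ⊕ z ≡ just v) (∧-comm a b) b′⊕[a∧b]
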